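{- Let $t'$ be a correct $\lambda^{\#}$-term and $t$ a $\lambda$-term with $t'\ltimes t$. Then: (1) if $t\to_\beta s$, there exists a correct $s'$ such that $t'\to_{\#}^{*}s'$ and $s'\ltimes s$; (2) if $t'\to_{\#}s'$, there exist a $\lambda$-term $s$ and a correct $\lambda^{\#}$-term $s''$ such that $t\to_\beta s$, $s'\to_{\#}^{*}s''$, and $s''\ltimes s$.
   Context: $\lambda$-terms: $t::=x\mid\lambda x.t\mid t\,t$, with $\beta$-reduction $\to_\beta$ (contextual closure of $(\lambda x.t)s\to t[x:=s]$). The distributive $\lambda$-calculus $\lambda^{\#}$: types $\mathcal{A}::=\alpha^\ell\mid\mathcal{M}\xrightarrow{\ell}\mathcal{A}$ ($\mathcal{M}$ a finite multiset of types, $\ell$ a label called the external label); terms $t::=x^{\mathcal{A}}\mid\lambda^\ell x.t\mid t[s_1,\dots,s_n]$ ($n\ge0$); typing: $x:[\mathcal{A}]\vdash x^{\mathcal{A}}:\mathcal{A}$; from $\Gamma\oplus(x:\mathcal{M})\vdash t:\mathcal{B}$ infer $\Gamma\vdash\lambda^\ell x.t:\mathcal{M}\xrightarrow{\ell}\mathcal{B}$; from $\Gamma\vdash t:[\mathcal{B}_1..\mathcal{B}_n]\xrightarrow{\ell}\mathcal{A}$, $\Delta_i\vdash s_i:\mathcal{B}_i$ infer $\Gamma+\sum\Delta_i\vdash t[s_1..s_n]:\mathcal{A}$ (contexts are finite partial maps to multisets, $+$ pointwise, $\oplus$ for disjoint domains). A multiset of types is sequential if its members have pairwise distinct external labels.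 Correct term: typable; distinct lambda occurrences carry distinct labels; every subterm has a context with sequential values; for every subterm with $\Gamma\vdash s:\mathcal{A}$, every subformula $\mathcal{M}\xrightarrow{\ell}\mathcal{B}$ of $\Gamma$ or $\mathcal{A}$ has $\mathcal{M}$ sequential. $\to_{\#}$: closure under contexts of $(\lambda^\ell x.t)\vec s\to t\{x:=\vec s\}$, where the linear type-directed substitution (defined when the multiset of types of free occurrences of $x$ in $t$ equals the multiset of types of $\vec s$) replaces each free occurrence $x^{\mathcal{A}}$ by the unique element of $\vec s$ of type $\mathcal{A}$. Refinement $t'\ltimes t$ (correct $\lambda^{\#}$-term $t'$, $\lambda$-term $t$) is defined inductively: $x^{\mathcal{A}}\ltimes x$; $\lambda^\ell x.t'\ltimes\lambda x.t$ if $t'\ltimes t$; $t'[s'_1,\dots,s'_n]\ltimes t\,s$ if $t'\ltimes t$ and $s'_i\ltimes s$ for all $i=1..n$ ($n\ge 0$). -}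

module Defs where

open import Data.Nat using (ℕ; zero; suc; _+_; _<_; pred; _<ᵇ_; _≡ᵇ_)
open import Data.Bool using (if_then_else_)
open import Data.List using (List; []; _∷_; _++_; map; length; lookup; zip)
open import Data.List.Relation.Unary.All using (All)
open import Data.List.Relation.Unary.Unique.Propositional using (Unique)
open import Data.List.Relation.Binary.Pointwise using (Pointwise)
open import Data.Fin using (Fin)
open import Data.Product using (Σ; _×_; _,_; proj₁; proj₂)
open import Data.Unit using (⊤)
open import Relation.Binary.PropositionalEquality using (_≡_)
open import Relation.Binary.Construct.Closure.ReflexiveTransitive using (Star)

data Λ : Set where
  var : ℕ → Λ
  lam : Λ → Λ
  app : Λ → Λ → Λ

shiftΛ : ℕ → ℕ → Λ → Λ
shiftΛ c n (var i)   = var (if i <ᵇ c then i else n + i)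
shiftΛ c n (lam t)   = lam (shiftΛ (suc c) n t)
shiftΛ c n (app t u) = app (shiftΛ c n t) (shiftΛ c n u)

substΛ : ℕ → Λ → Λ → Λ
substΛ d s (var i)   =
  if i <ᵇ d then var i else (if i ≡ᵇ d then shiftΛ 0 d s else var (pred i))
substΛ d s (lam t)   = lam (substΛ (suc d) s t)
substΛ d s (app t u) = app (substΛ d s t) (substΛ d s u)

infix 4 _→β_
data _→β_ : Λ → Λ → Set where
  β    : ∀ {t s} → app (lam t) s →β substΛ 0 s t
  lamξ : ∀ {t t'} → t →β t' → lam t →β lam t'
  appL : ∀ {t t' s} → t →β t' → app t s →β app t' s
  appR : ∀ {t s s'} → s →β s' → app t s →β app t s'

-- Types of the distributive λ-calculus; multisets as lists modulo
-- permutation (up to type equivalence)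

Label : Set
Label = ℕ

data Ty : Set where
  tvar  : ℕ → Label → Ty
  _⇒[_]_ : List Ty → Label → Ty → Ty

extLabel : Ty → Label
extLabel (tvar _ ℓ)   = ℓ
extLabel (_ ⇒[ ℓ ] _) = ℓ

infix 4 _≈ᵀ_ _≈ᴹ_
data _≈ᵀ_ : Ty → Ty → Set
data _≈ᴹ_ : List Ty → List Ty → Set

data _≈ᵀ_ where
  tvar : ∀ {α ℓ} → tvar α ℓ ≈ᵀ tvar α ℓ
  arr  : ∀ {M N ℓ A B} → M ≈ᴹ N → A ≈ᵀ B → (M ⇒[ ℓ ] A) ≈ᵀ (N ⇒[ ℓ ] B)

data _≈ᴹ_ where
  []   : [] ≈ᴹ []
  cons : ∀ {A B M N} (N₁ N₂ : List Ty) → A ≈ᵀ B → M ≈ᴹ (N₁ ++ N₂) →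
         N ≡ N₁ ++ B ∷ N₂ → (A ∷ M) ≈ᴹ N

Sequential : List Ty → Set
Sequential M = Unique (map extLabel M)

SeqTy  : Ty → Set
SeqTys : List Ty → Set
SeqTy (tvar _ _)   = ⊤
SeqTy (M ⇒[ _ ] B) = Sequential M × SeqTys M × SeqTy B
SeqTys []       = ⊤
SeqTys (A ∷ M)  = SeqTy A × SeqTys M

data Tm : Set where
  var : ℕ → Ty → Tm
  lam : Label → Tm → Tm
  app : Tm → List Tm → Tm

shift  : ℕ → ℕ → Tm → Tm
shifts : ℕ → ℕ → List Tm → List Tm
shift c n (var i A)  = var (if i <ᵇ c then i else n + i) A
shift c n (lam ℓ t)  = lam ℓ (shift (suc c) n t)
shift c n (app t ss) = app (shift c n t) (shifts c n ss)
shifts c n []       = []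
shifts c n (s ∷ ss) = shift c n s ∷ shifts c n ss

lamLabels  : Tm → List Label
lamLabelss : List Tm → List Label
lamLabels (var _ _)   = []
lamLabels (lam ℓ t)   = ℓ ∷ lamLabels t
lamLabels (app t ss)  = lamLabels t ++ lamLabelss ss
lamLabelss []       = []
lamLabelss (s ∷ ss) = lamLabels s ++ lamLabelss ss

occ  : ℕ → Tm → List Ty
occs : ℕ → List Tm → List Ty
occ d (var i A)  = if i ≡ᵇ d then A ∷ [] else []
occ d (lam _ t)  = occ (suc d) t
occ d (app t ss) = occ d t ++ occs d ss
occs d []       = []
occs d (s ∷ ss) = occ d s ++ occs d ss

-- Typing. Contexts: total maps from indices to multisets (x : [] = absent)

Ctx : Set
Ctx = ℕ → List Ty

∅ : Ctx
∅ _ = []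

_+ᶜ_ : Ctx → Ctx → Ctx
(Γ +ᶜ Δ) y = Γ y ++ Δ y

_∷ᶜ_ : List Ty → Ctx → Ctx
(M ∷ᶜ Γ) zero    = M
(M ∷ᶜ Γ) (suc y) = Γ y

single : ℕ → Ty → Ctx
single i A y = if y ≡ᵇ i then A ∷ [] else []

_≈ᶜ_ : Ctx → Ctx → Set
Γ ≈ᶜ Δ = ∀ y → Γ y ≈ᴹ Δ y

infix 3 _⊢_∶_ _⊢*_∶_
data _⊢_∶_  : Ctx → Tm → Ty → Set
data _⊢*_∶_ : Ctx → List Tm → List Ty → Set

data _⊢_∶_ where
  var : ∀ {Γ i A} → Γ ≈ᶜ single i A → Γ ⊢ var i A ∶ A
  lam : ∀ {Γ M ℓ t B} → (M ∷ᶜ Γ) ⊢ t ∶ B → Γ ⊢ lam ℓ t ∶ (M ⇒[ ℓ ] B)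
  app : ∀ {Γ Γt Δ t ss M ℓ A Bs} →
        Γt ⊢ t ∶ (M ⇒[ ℓ ] A) → Δ ⊢* ss ∶ Bs → M ≈ᴹ Bs →
        Γ ≈ᶜ (Γt +ᶜ Δ) → Γ ⊢ app t ss ∶ A

data _⊢*_∶_ where
  []  : ∀ {Γ} → Γ ≈ᶜ ∅ → Γ ⊢* [] ∶ []
  _∷_ : ∀ {Γ Δ₁ Δ₂ s ss B Bs} → Δ₁ ⊢ s ∶ B → Δ₂ ⊢* ss ∶ Bs →
        Γ ≈ᶜ (Δ₁ +ᶜ Δ₂) → Γ ⊢* (s ∷ ss) ∶ (B ∷ Bs)

Every  : (Ctx → Ty → Set) → ∀ {Γ t A} → Γ ⊢ t ∶ A → Set
Every* : (Ctx → Ty → Set) → ∀ {Γ ss As} → Γ ⊢* ss ∶ As → Set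
Every P {Γ} {A = A} (var _)         = P Γ A
Every P {Γ} {A = A} (lam d)         = P Γ A × Every P d
Every P {Γ} {A = A} (app d ds _ _)  = P Γ A × Every P d × Every* P ds
Every* P ([] _)       = ⊤
Every* P (_∷_ d ds _) = Every P d × Every* P ds

GoodJ : Ctx → Ty → Set
GoodJ Γ A = (∀ y → Sequential (Γ y)) × (∀ y → SeqTys (Γ y)) × SeqTy A

Correct : Tm → Set
Correct t = Σ Ctx λ Γ → Σ Ty λ A → Σ (Γ ⊢ t ∶ A) λ d →
            Every GoodJ d × Unique (lamLabels t)

-- Linear type-directed substitution t{x := s⃗}, x = index d,
-- σ = arguments paired with their types

data LSub  (σ : List (Tm × Ty)) : ℕ → Tm → Tm → Set
data LSubs (σ : List (Tm × Ty)) : ℕ → List Tm → List Tm → Set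

data LSub σ where
  hit   : ∀ {d A} (k : Fin (length σ)) → proj₂ (lookup σ k) ≈ᵀ A →
          (∀ j → proj₂ (lookup σ j) ≈ᵀ A → j ≡ k) →
          LSub σ d (var d A) (shift 0 d (proj₁ (lookup σ k)))
  below : ∀ {d i A} → i < d → LSub σ d (var i A) (var i A)
  above : ∀ {d i A} → d < i → LSub σ d (var i A) (var (pred i) A)
  lam   : ∀ {d ℓ t u} → LSub σ (suc d) t u → LSub σ d (lam ℓ t) (lam ℓ u)
  app   : ∀ {d t u ss us} → LSub σ d t u → LSubs σ d ss us →
          LSub σ d (app t ss) (app u us)

data LSubs σ where
  []  : ∀ {d} → LSubs σ d [] []
  _∷_ : ∀ {d s u ss us} → LSub σ d s u → LSubs σ d ss us →
        LSubs σ d (s ∷ ss) (u ∷ us)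

HasType : Tm → Ty → Set
HasType s B = Σ Ctx λ Γ → Γ ⊢ s ∶ B

infix 4 _→#_ _→#s_
data _→#_  : Tm → Tm → Set
data _→#s_ : List Tm → List Tm → Set

data _→#_ where
  β#   : ∀ {ℓ t ss r} (Bs : List Ty) → Pointwise HasType ss Bs →
         occ 0 t ≈ᴹ Bs → LSub (zip ss Bs) 0 t r →
         app (lam ℓ t) ss →# r
  lamξ : ∀ {ℓ t t'} → t →# t' → lam ℓ t →# lam ℓ t'
  appL : ∀ {t t' ss} → t →# t' → app t ss →# app t' ss
  appR : ∀ {t ss ss'} → ss →#s ss' → app t ss →# app t ss'

data _→#s_ where
  here  : ∀ {s s' ss} → s →# s' → (s ∷ ss) →#s (s' ∷ ss)
  there : ∀ {s ss ss'} → ss →#s ss' → (s ∷ ss) →#s (s ∷ ss')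

_→#*_ : Tm → Tm → Set
_→#*_ = Star _→#_

infix 4 _⋉_
data _⋉_ : Tm → Λ → Set where
  var : ∀ {i A} → var i A ⋉ var i
  lam : ∀ {ℓ t' t} → t' ⋉ t → lam ℓ t' ⋉ lam t
  app : ∀ {t' t ss' s} → t' ⋉ t → All (_⋉ s) ss' → app t' ss' ⋉ app t s

-- Linear substitution commutes with refinement: if u′ ⋉ u and every argument refines s, then
-- u′{x := s⃗′} ⋉ u[x := s].  Hence a β-step of t is simulated by contracting every copy of the
-- redex in t′, and a β#-step of t′ by the corresponding β-step of t followed by contracting the
-- remaining copies.  Each copy can be contracted because in a correct term the argument types
-- of a redex are sequential, so the type-directed substitution has exactly one candidate for
-- each occurrence.  The terms reached stay correct by subject reduction: t{x := s⃗} is typed in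
-- the context (Γ ∖ x) + Σ Δᵢ, whose entries are sub-multisets of the context of the redex, and
-- since every argument is substituted exactly once, lambda labels can only disappear.

module Submission where

open import Defs
open import Data.Bool using (true; false; if_then_else_)
open import Data.Empty using (⊥-elim)
open import Data.Fin using (Fin; zero; suc)
open import Data.List using (List; []; _∷_; _++_; map; length; lookup; zip; allFin; tabulate)
open import Data.List.Properties
  using (++-assoc; ++-identityʳ; map-++; ∷-injectiveˡ; ∷-injectiveʳ; map-tabulate; tabulate-lookup)
open import Data.List.Membership.Propositional.Properties using (∈-∃++; ∈-lookup; ∈-map⁺)
open import Data.List.Relation.Unary.All as All using (All; []; _∷_)
import Data.List.Relation.Unary.All.Properties as All
open import Data.List.Relation.Unary.AllPairs using ([]; _∷_)
open import Data.List.Relation.Unary.Any as Any using (Any; here; there)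
import Data.List.Relation.Unary.Any.Properties as Any
open import Data.List.Relation.Unary.Unique.Propositional using (Unique)
open import Data.List.Relation.Binary.Pointwise as Pointwise using (Pointwise; []; _∷_)
open import Data.List.Relation.Binary.Permutation.Propositional
  using (_↭_; ↭-refl; ↭-sym; ↭-trans; ↭-prep; ↭-reflexive; ↭⇒↭ₛ; refl; prep; swap; trans)
import Data.List.Relation.Binary.Permutation.Propositional.Properties as ↭
import Data.List.Relation.Binary.Permutation.Setoid.Properties as ↭ₛ
open import Data.Maybe as Maybe using (Maybe; just; nothing; maybe′)
open import Data.Nat using (ℕ; zero; suc; _+_; _<_; pred; _<ᵇ_; _≡ᵇ_; s≤s)
open import Data.Nat.Properties using (+-suc; <-cmp)
open import Data.Product using (Σ; Σ-syntax; ∃-syntax; _×_; _,_; proj₁; proj₂)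
open import Data.Unit using (tt)
open import Function using (_∘_; id)
open import Relation.Binary.Construct.Closure.ReflexiveTransitive using (Star; ε; _◅_; _◅◅_; gmap)
open import Relation.Binary.Definitions using (tri<; tri≈; tri>)
open import Relation.Binary.PropositionalEquality as ≡
  using (_≡_; refl; sym; cong; cong₂; cong-app; subst; setoid; module ≡-Reasoning)

≡ᵇ-refl : ∀ d → (d ≡ᵇ d) ≡ true
≡ᵇ-refl zero    = refl
≡ᵇ-refl (suc d) = ≡ᵇ-refl d

≡ᵇ-sym : ∀ a b → (a ≡ᵇ b) ≡ (b ≡ᵇ a)
≡ᵇ-sym zero    zero    = refl
≡ᵇ-sym zero    (suc b) = refl
≡ᵇ-sym (suc a) zero    = refl
≡ᵇ-sym (suc a) (suc b) = ≡ᵇ-sym a b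

<⇒≡ᵇ-false : ∀ {i d} → i < d → (i ≡ᵇ d) ≡ false
<⇒≡ᵇ-false {zero}  {suc d} _         = refl
<⇒≡ᵇ-false {suc i} {suc d} (s≤s i<d) = <⇒≡ᵇ-false i<d

>⇒≡ᵇ-false : ∀ {i d} → d < i → (i ≡ᵇ d) ≡ false
>⇒≡ᵇ-false {suc i} {zero}  _         = refl
>⇒≡ᵇ-false {suc i} {suc d} (s≤s d<i) = >⇒≡ᵇ-false d<i

<ᵇ-irrefl : ∀ d → (d <ᵇ d) ≡ false
<ᵇ-irrefl zero    = refl
<ᵇ-irrefl (suc d) = <ᵇ-irrefl d

<⇒<ᵇ-true : ∀ {i d} → i < d → (i <ᵇ d) ≡ true
<⇒<ᵇ-true {zero}  {suc d} _         = refl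
<⇒<ᵇ-true {suc i} {suc d} (s≤s i<d) = <⇒<ᵇ-true i<d

>⇒<ᵇ-false : ∀ {i d} → d < i → (i <ᵇ d) ≡ false
>⇒<ᵇ-false {suc i} {zero}  _         = refl
>⇒<ᵇ-false {suc i} {suc d} (s≤s d<i) = >⇒<ᵇ-false d<i

↭-interchange : ∀ {X : Set} (a b c d : List X) → ((a ++ b) ++ (c ++ d)) ↭ ((a ++ c) ++ (b ++ d))
↭-interchange a b c d = ↭-trans (↭.++-assoc a b (c ++ d))
  (↭-trans (↭.++⁺ˡ a (↭.shifts b c)) (↭-sym (↭.++-assoc a c (b ++ d))))

Unique-resp-↭ : ∀ {X : Set} {xs ys : List X} → xs ↭ ys → Unique xs → Unique ys
Unique-resp-↭ {X} p = ↭ₛ.Unique-resp-↭ (setoid X) (↭⇒↭ₛ p)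

Unique-++⁻ˡ : ∀ {X : Set} (xs : List X) {ys} → Unique (xs ++ ys) → Unique xs
Unique-++⁻ˡ []       u       = []
Unique-++⁻ˡ (_ ∷ xs) (a ∷ u) = All.++⁻ˡ xs a ∷ Unique-++⁻ˡ xs u

map-split : ∀ {X Y : Set} (f : X → Y) xs N₁ {B} N₂ → map f xs ≡ N₁ ++ B ∷ N₂ →
  ∃[ xs₁ ] ∃[ x ] ∃[ xs₂ ] xs ≡ xs₁ ++ x ∷ xs₂ × map f xs₁ ≡ N₁ × f x ≡ B × map f xs₂ ≡ N₂
map-split f (x ∷ xs) []       N₂ e = [] , x , xs , refl , refl , ∷-injectiveˡ e , ∷-injectiveʳ e
map-split f (x ∷ xs) (_ ∷ N₁) N₂ e
  with xs₁ , x′ , xs₂ , refl , e₁ , e₂ , e₃ ← map-split f xs N₁ N₂ (∷-injectiveʳ e) =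
  x ∷ xs₁ , x′ , xs₂ , refl , cong₂ _∷_ (∷-injectiveˡ e) e₁ , e₂ , e₃

map-lookup-allFin : ∀ {X Y : Set} (f : X → Y) (xs : List X) →
                    map (f ∘ lookup xs) (allFin (length xs)) ≡ map f xs
map-lookup-allFin f xs = begin
  map (f ∘ lookup xs) (tabulate id) ≡⟨ map-tabulate id (f ∘ lookup xs) ⟩
  tabulate (f ∘ lookup xs)          ≡⟨ map-tabulate (lookup xs) f ⟨
  map f (tabulate (lookup xs))      ≡⟨ cong (map f) (tabulate-lookup xs) ⟩
  map f xs                          ∎
  where open ≡-Reasoning

map-proj₁-zip : ∀ {X Y : Set} {R : X → Y → Set} {xs ys} → Pointwise R xs ys → map proj₁ (zip xs ys) ≡ xs
map-proj₁-zip []       = refl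
map-proj₁-zip (_ ∷ rs) = cong (_ ∷_) (map-proj₁-zip rs)

map-proj₂-zip : ∀ {X Y : Set} {R : X → Y → Set} {xs ys} → Pointwise R xs ys → map proj₂ (zip xs ys) ≡ ys
map-proj₂-zip []       = refl
map-proj₂-zip (_ ∷ rs) = cong (_ ∷_) (map-proj₂-zip rs)

infix 4 _≋_
_≋_ : List Ty → List Ty → Set
_≋_ = Pointwise _≈ᵀ_

≈ᵀ-refl : ∀ A → A ≈ᵀ A
≈ᴹ-refl : ∀ M → M ≈ᴹ M
≈ᵀ-refl (tvar _ _)   = tvar
≈ᵀ-refl (M ⇒[ _ ] B) = arr (≈ᴹ-refl M) (≈ᵀ-refl B)
≈ᴹ-refl []      = []
≈ᴹ-refl (A ∷ M) = cons [] M (≈ᵀ-refl A) (≈ᴹ-refl M) refl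

≋-refl : ∀ M → M ≋ M
≋-refl M = Pointwise.refl (≈ᵀ-refl _)

≈ᴹ-reflexive : ∀ {M N} → M ≡ N → M ≈ᴹ N
≈ᴹ-reflexive {M} refl = ≈ᴹ-refl M

≈ᴹ-insert : ∀ {A B M} N₁ N₂ → (N₁ ++ N₂) ≈ᴹ M → B ≈ᵀ A → (N₁ ++ B ∷ N₂) ≈ᴹ (A ∷ M)
≈ᴹ-insert []       N₂ r e = cons [] _ e r refl
≈ᴹ-insert (_ ∷ N₁) N₂ (cons P₁ P₂ e′ r refl) e = cons (_ ∷ P₁) P₂ e′ (≈ᴹ-insert N₁ N₂ r e) refl

≈ᵀ-sym : ∀ {A B} → A ≈ᵀ B → B ≈ᵀ A
≈ᴹ-sym : ∀ {M N} → M ≈ᴹ N → N ≈ᴹ M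
≈ᵀ-sym tvar      = tvar
≈ᵀ-sym (arr m b) = arr (≈ᴹ-sym m) (≈ᵀ-sym b)
≈ᴹ-sym []                     = []
≈ᴹ-sym (cons N₁ N₂ e r refl) = ≈ᴹ-insert N₁ N₂ (≈ᴹ-sym r) (≈ᵀ-sym e)

≈ᴹ⇒≋↭ : ∀ {M N} → M ≈ᴹ N → ∃[ M′ ] M ≋ M′ × M′ ↭ N
≈ᴹ⇒≋↭ [] = [] , [] , ↭-refl
≈ᴹ⇒≋↭ (cons {B = B} N₁ N₂ e r refl) with M′ , pw , p ← ≈ᴹ⇒≋↭ r =
  B ∷ M′ , e ∷ pw , ↭-trans (↭-prep B p) (↭-sym (↭.shift B N₁ N₂))

≋↭⇒≈ᴹ : ∀ {M M′ N} → M ≋ M′ → M′ ↭ N → M ≈ᴹ N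
≋↭⇒≈ᴹ [] p rewrite ↭.↭-empty-inv (↭-sym p) = []
≋↭⇒≈ᴹ (e ∷ pw) p with N₁ , N₂ , refl ← ∈-∃++ (↭.∈-resp-↭ p (here refl)) =
  cons N₁ N₂ e (≋↭⇒≈ᴹ pw (↭.drop-mid [] N₁ p)) refl

↭⇒≈ᴹ : ∀ {M N} → M ↭ N → M ≈ᴹ N
↭⇒≈ᴹ = ≋↭⇒≈ᴹ (≋-refl _)

≋⇒≈ᴹ : ∀ {M N} → M ≋ N → M ≈ᴹ N
≋⇒≈ᴹ pw = ≋↭⇒≈ᴹ pw ↭-refl

≈ᴹ-trans-↭ : ∀ {M N L} → M ≈ᴹ N → N ↭ L → M ≈ᴹ L
≈ᴹ-trans-↭ m p with _ , pw , q ← ≈ᴹ⇒≋↭ m = ≋↭⇒≈ᴹ pw (↭-trans q p)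

≋-split : ∀ {B N′} N₁ N₂ → (N₁ ++ B ∷ N₂) ≋ N′ →
          ∃[ N₁′ ] ∃[ B′ ] ∃[ N₂′ ] N′ ≡ N₁′ ++ B′ ∷ N₂′ × B ≈ᵀ B′ × (N₁ ++ N₂) ≋ (N₁′ ++ N₂′)
≋-split []       N₂ (e ∷ pw) = [] , _ , _ , refl , e , pw
≋-split (_ ∷ N₁) N₂ (e ∷ pw) with N₁′ , B′ , N₂′ , refl , b , pw′ ← ≋-split N₁ N₂ pw =
  _ ∷ N₁′ , B′ , N₂′ , refl , b , e ∷ pw′

-- Going through ≋ keeps the recursion structural in the first derivation.
≈ᵀ-trans : ∀ {A B C} → A ≈ᵀ B → B ≈ᵀ C → A ≈ᵀ C
≈ᴹ-trans : ∀ {M N L} → M ≈ᴹ N → N ≈ᴹ L → M ≈ᴹ L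
≈ᴹ-trans-≋ : ∀ {M N N′} → M ≈ᴹ N → N ≋ N′ → M ≈ᴹ N′
≈ᵀ-trans tvar      tvar        = tvar
≈ᵀ-trans (arr m b) (arr m′ b′) = arr (≈ᴹ-trans m m′) (≈ᵀ-trans b b′)
≈ᴹ-trans m n with _ , pw , p ← ≈ᴹ⇒≋↭ n = ≈ᴹ-trans-↭ (≈ᴹ-trans-≋ m pw) p
≈ᴹ-trans-≋ [] [] = []
≈ᴹ-trans-≋ (cons N₁ N₂ e r refl) pw with N₁′ , _ , N₂′ , refl , b , pw′ ← ≋-split N₁ N₂ pw =
  cons N₁′ N₂′ (≈ᵀ-trans e b) (≈ᴹ-trans-≋ r pw′) refl

≈ᴹ-++⁺ : ∀ {M M′ N N′} → M ≈ᴹ M′ → N ≈ᴹ N′ → (M ++ N) ≈ᴹ (M′ ++ N′)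
≈ᴹ-++⁺ m n with _ , pw₁ , p₁ ← ≈ᴹ⇒≋↭ m | _ , pw₂ , p₂ ← ≈ᴹ⇒≋↭ n =
  ≋↭⇒≈ᴹ (Pointwise.++⁺ pw₁ pw₂) (↭.++⁺ p₁ p₂)

≈ᴹ-++-comm : ∀ M N → (M ++ N) ≈ᴹ (N ++ M)
≈ᴹ-++-comm M N = ↭⇒≈ᴹ (↭.++-comm M N)

≈ᴹ-++-assoc : ∀ M N L → ((M ++ N) ++ L) ≈ᴹ (M ++ (N ++ L))
≈ᴹ-++-assoc M N L = ≈ᴹ-reflexive (++-assoc M N L)

≈ᴹ-interchange : ∀ a b c d → ((a ++ b) ++ (c ++ d)) ≈ᴹ ((a ++ c) ++ (b ++ d))
≈ᴹ-interchange a b c d = ↭⇒≈ᴹ (↭-interchange a b c d)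

≈ᴹ⇒Any : ∀ {M N} → M ≈ᴹ N → All (λ A → Any (_≈ᵀ A) N) M
≈ᴹ⇒Any []                              = []
≈ᴹ⇒Any (cons {B = B} N₁ N₂ e r refl) =
  insert (here (≈ᵀ-sym e)) ∷ All.map (insert ∘ there) (≈ᴹ⇒Any r)
  where
    insert : ∀ {A} → Any (_≈ᵀ A) (B ∷ N₁ ++ N₂) → Any (_≈ᵀ A) (N₁ ++ B ∷ N₂)
    insert = ↭.Any-resp-↭ (↭-sym (↭.shift B N₁ N₂))

map-≈ᴹ⇒↭ : ∀ {X : Set} (f : X → Ty) (xs ys : List X) →
  All (λ x → ∀ y → f y ≈ᵀ f x → y ≡ x) xs → map f xs ≈ᴹ map f ys → xs ↭ ys
map-≈ᴹ⇒↭ f []       []  _        _ = ↭-refl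
map-≈ᴹ⇒↭ f (x ∷ xs) ys (inj ∷ injs) (cons N₁ N₂ e r eq)
  with ys₁ , y , ys₂ , refl , refl , refl , refl ← map-split f ys N₁ N₂ eq
  with refl ← inj y (≈ᵀ-sym e) =
  ↭-trans (↭-prep x (map-≈ᴹ⇒↭ f xs (ys₁ ++ ys₂) injs (subst (map f xs ≈ᴹ_) (sym (map-++ f ys₁ ys₂)) r)))
          (↭-sym (↭.shift x ys₁ ys₂))

extLabel-≈ᵀ : ∀ {A B} → A ≈ᵀ B → extLabel A ≡ extLabel B
extLabel-≈ᵀ tvar      = refl
extLabel-≈ᵀ (arr _ _) = refl

extLabels-≋ : ∀ {M N} → M ≋ N → map extLabel M ≡ map extLabel N
extLabels-≋ []       = refl
extLabels-≋ (e ∷ pw) = cong₂ _∷_ (extLabel-≈ᵀ e) (extLabels-≋ pw)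

extLabels-≈ᴹ : ∀ {M N} → M ≈ᴹ N → map extLabel M ↭ map extLabel N
extLabels-≈ᴹ m with _ , pw , p ← ≈ᴹ⇒≋↭ m =
  subst (_↭ _) (sym (extLabels-≋ pw)) (↭.map⁺ extLabel p)

Sequential-resp-≈ᴹ : ∀ {M N} → M ≈ᴹ N → Sequential M → Sequential N
Sequential-resp-≈ᴹ m = Unique-resp-↭ (extLabels-≈ᴹ m)

SeqTys⇒All : ∀ {M} → SeqTys M → All SeqTy M
SeqTys⇒All {[]}    _       = []
SeqTys⇒All {_ ∷ _} (a , m) = a ∷ SeqTys⇒All m

All⇒SeqTys : ∀ {M} → All SeqTy M → SeqTys M
All⇒SeqTys []      = tt
All⇒SeqTys (a ∷ m) = a , All⇒SeqTys m

SeqTy-resp-≈ᵀ : ∀ {A B} → A ≈ᵀ B → SeqTy A → SeqTy B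
All-SeqTy-resp-≈ᴹ : ∀ {M N} → M ≈ᴹ N → All SeqTy M → All SeqTy N
SeqTy-resp-≈ᵀ tvar      _            = tt
SeqTy-resp-≈ᵀ (arr m b) (sq , st , sb) =
  Sequential-resp-≈ᴹ m sq , All⇒SeqTys (All-SeqTy-resp-≈ᴹ m (SeqTys⇒All st)) , SeqTy-resp-≈ᵀ b sb
All-SeqTy-resp-≈ᴹ []                    _        = []
All-SeqTy-resp-≈ᴹ (cons N₁ N₂ e r refl) (a ∷ as) with q ← All-SeqTy-resp-≈ᴹ r as =
  All.++⁺ (All.++⁻ˡ N₁ q) (SeqTy-resp-≈ᵀ e a ∷ All.++⁻ʳ N₁ q)

Good : List Ty → Set
Good M = Sequential M × SeqTys M

Good-[] : Good []
Good-[] = [] , tt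

Good-resp-≈ᴹ : ∀ {M N} → M ≈ᴹ N → Good M → Good N
Good-resp-≈ᴹ m (sq , st) = Sequential-resp-≈ᴹ m sq , All⇒SeqTys (All-SeqTy-resp-≈ᴹ m (SeqTys⇒All st))

Good-++⁻ˡ : ∀ {M N} → Good (M ++ N) → Good M
Good-++⁻ˡ {M} {N} (sq , st) =
  Unique-++⁻ˡ (map extLabel M) (subst Unique (map-++ extLabel M N) sq) ,
  All⇒SeqTys (All.++⁻ˡ M (SeqTys⇒All st))

Good-++⁻ : ∀ {M N L} → (M ++ N) ≈ᴹ L → Good L → Good M × Good N
Good-++⁻ {M} {N} e g = Good-++⁻ˡ g′ , Good-++⁻ˡ (Good-resp-≈ᴹ (≈ᴹ-++-comm M N) g′)
  where g′ = Good-resp-≈ᴹ (≈ᴹ-sym e) g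

≈ᶜ-refl : ∀ {Γ} → Γ ≈ᶜ Γ
≈ᶜ-refl {Γ} y = ≈ᴹ-refl (Γ y)

≈ᶜ-reflexive : ∀ {Γ Δ} → (∀ y → Γ y ≡ Δ y) → Γ ≈ᶜ Δ
≈ᶜ-reflexive e y = ≈ᴹ-reflexive (e y)

≈ᶜ-sym : ∀ {Γ Δ} → Γ ≈ᶜ Δ → Δ ≈ᶜ Γ
≈ᶜ-sym e y = ≈ᴹ-sym (e y)

≈ᶜ-trans : ∀ {Γ Δ Θ} → Γ ≈ᶜ Δ → Δ ≈ᶜ Θ → Γ ≈ᶜ Θ
≈ᶜ-trans e f y = ≈ᴹ-trans (e y) (f y)

+ᶜ-cong : ∀ {Γ Γ′ Δ Δ′} → Γ ≈ᶜ Γ′ → Δ ≈ᶜ Δ′ → (Γ +ᶜ Δ) ≈ᶜ (Γ′ +ᶜ Δ′)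
+ᶜ-cong e f y = ≈ᴹ-++⁺ (e y) (f y)

∷ᶜ-cong : ∀ {M N Γ Δ} → M ≈ᴹ N → Γ ≈ᶜ Δ → (M ∷ᶜ Γ) ≈ᶜ (N ∷ᶜ Δ)
∷ᶜ-cong m e zero    = m
∷ᶜ-cong m e (suc y) = e y

GoodCtx : Ctx → Set
GoodCtx Γ = ∀ y → Good (Γ y)

GoodCtx-resp-≈ᶜ : ∀ {Γ Δ} → Γ ≈ᶜ Δ → GoodCtx Γ → GoodCtx Δ
GoodCtx-resp-≈ᶜ e g y = Good-resp-≈ᴹ (e y) (g y)

GoodCtx-+ᶜ⁻ : ∀ {Γ Γ₁ Γ₂} → Γ ≈ᶜ (Γ₁ +ᶜ Γ₂) → GoodCtx Γ → GoodCtx Γ₁ × GoodCtx Γ₂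
GoodCtx-+ᶜ⁻ e g = (λ y → proj₁ (split y)) , (λ y → proj₂ (split y))
  where split = λ y → Good-++⁻ (≈ᴹ-sym (e y)) (g y)

GoodCtx-∷ᶜ : ∀ {M Γ} → Good M → GoodCtx Γ → GoodCtx (M ∷ᶜ Γ)
GoodCtx-∷ᶜ m g zero    = m
GoodCtx-∷ᶜ m g (suc y) = g y

mkGoodJ : ∀ {Γ A} → GoodCtx Γ → SeqTy A → GoodJ Γ A
mkGoodJ g s = (λ y → proj₁ (g y)) , (λ y → proj₂ (g y)) , s

GoodJ⇒GoodCtx : ∀ {Γ A} → GoodJ Γ A → GoodCtx Γ
GoodJ⇒GoodCtx (sq , st , _) y = sq y , st y

GoodJ⇒SeqTy : ∀ {Γ A} → GoodJ Γ A → SeqTy A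
GoodJ⇒SeqTy (_ , _ , s) = s

GoodJ-resp : ∀ {Γ Γ′ A A′} → Γ ≈ᶜ Γ′ → A ≈ᵀ A′ → GoodJ Γ A → GoodJ Γ′ A′
GoodJ-resp e a g =
  mkGoodJ (λ y → Good-resp-≈ᴹ (e y) (GoodJ⇒GoodCtx g y)) (SeqTy-resp-≈ᵀ a (GoodJ⇒SeqTy g))

punchIn : ℕ → ℕ → ℕ
punchIn zero    y       = suc y
punchIn (suc d) zero    = zero
punchIn (suc d) (suc y) = suc (punchIn d y)

delᶜ : ℕ → Ctx → Ctx
delᶜ d Γ y = Γ (punchIn d y)

delᶜ-cong : ∀ {Γ Δ} d → Γ ≈ᶜ Δ → delᶜ d Γ ≈ᶜ delᶜ d Δ
delᶜ-cong d e y = e (punchIn d y)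

punchIn-≢ : ∀ d y → (punchIn d y ≡ᵇ d) ≡ false
punchIn-≢ zero    y       = refl
punchIn-≢ (suc d) zero    = refl
punchIn-≢ (suc d) (suc y) = punchIn-≢ d y

punchIn-< : ∀ {i d} → i < d → ∀ y → (punchIn d y ≡ᵇ i) ≡ (y ≡ᵇ i)
punchIn-< {zero}  {suc d} _         zero    = refl
punchIn-< {zero}  {suc d} _         (suc y) = refl
punchIn-< {suc i} {suc d} _         zero    = refl
punchIn-< {suc i} {suc d} (s≤s i<d) (suc y) = punchIn-< i<d y

punchIn-> : ∀ {d i} → d < i → ∀ y → (punchIn d y ≡ᵇ i) ≡ (y ≡ᵇ pred i)
punchIn-> {zero}  {suc i}       _         y       = refl
punchIn-> {suc d} {suc zero}    (s≤s ())  _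
punchIn-> {suc d} {suc (suc i)} _         zero    = refl
punchIn-> {suc d} {suc (suc i)} (s≤s d<i) (suc y) = punchIn-> d<i y

delᶜ-single-≡ : ∀ d A → delᶜ d (single d A) ≈ᶜ ∅
delᶜ-single-≡ d A = ≈ᶜ-reflexive λ y → cong (λ b → if b then A ∷ [] else []) (punchIn-≢ d y)

delᶜ-single-< : ∀ {i d} A → i < d → delᶜ d (single i A) ≈ᶜ single i A
delᶜ-single-< A i<d = ≈ᶜ-reflexive λ y → cong (λ b → if b then A ∷ [] else []) (punchIn-< i<d y)

delᶜ-single-> : ∀ {i d} A → d < i → delᶜ d (single i A) ≈ᶜ single (pred i) A
delᶜ-single-> A d<i = ≈ᶜ-reflexive λ y → cong (λ b → if b then A ∷ [] else []) (punchIn-> d<i y)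

unshiftIdx : ℕ → ℕ → ℕ → Maybe ℕ
unshiftIdx zero    zero    y       = just y
unshiftIdx zero    (suc n) zero    = nothing
unshiftIdx zero    (suc n) (suc y) = unshiftIdx zero n y
unshiftIdx (suc c) n       zero    = just zero
unshiftIdx (suc c) n       (suc y) = Maybe.map suc (unshiftIdx c n y)

-- the context of shift c n t: the n indices from c on are empty
shiftᶜ : ℕ → ℕ → Ctx → Ctx
shiftᶜ c n Γ y = maybe′ Γ [] (unshiftIdx c n y)

shiftᶜ-cong : ∀ {Γ Δ} c n → Γ ≈ᶜ Δ → shiftᶜ c n Γ ≈ᶜ shiftᶜ c n Δ
shiftᶜ-cong c n e y with unshiftIdx c n y
... | nothing = []
... | just j  = e j

shiftᶜ-+ᶜ : ∀ c n Γ Δ → shiftᶜ c n (Γ +ᶜ Δ) ≈ᶜ (shiftᶜ c n Γ +ᶜ shiftᶜ c n Δ)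
shiftᶜ-+ᶜ c n Γ Δ y with unshiftIdx c n y
... | nothing = []
... | just j  = ≈ᴹ-refl _

shiftᶜ-∅ : ∀ c n → shiftᶜ c n ∅ ≈ᶜ ∅
shiftᶜ-∅ c n y with unshiftIdx c n y
... | nothing = []
... | just j  = []

shiftᶜ-∷ᶜ : ∀ c n M Γ → shiftᶜ (suc c) n (M ∷ᶜ Γ) ≈ᶜ (M ∷ᶜ shiftᶜ c n Γ)
shiftᶜ-∷ᶜ c n M Γ zero    = ≈ᴹ-refl M
shiftᶜ-∷ᶜ c n M Γ (suc y) with unshiftIdx c n y
... | nothing = []
... | just j  = ≈ᴹ-refl _

GoodCtx-shiftᶜ : ∀ {Γ} c n → GoodCtx Γ → GoodCtx (shiftᶜ c n Γ)
GoodCtx-shiftᶜ c n g y with unshiftIdx c n y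
... | nothing = Good-[]
... | just j  = g j

GoodJ-shiftᶜ : ∀ {Γ} c n A → GoodJ Γ A → GoodJ (shiftᶜ c n Γ) A
GoodJ-shiftᶜ c n A g = mkGoodJ (GoodCtx-shiftᶜ c n (GoodJ⇒GoodCtx {A = A} g)) (GoodJ⇒SeqTy {A = A} g)

shiftIdx : ℕ → ℕ → ℕ → ℕ
shiftIdx c n i = if i <ᵇ c then i else n + i

shiftIdx-suc : ∀ c n i → shiftIdx (suc c) n (suc i) ≡ suc (shiftIdx c n i)
shiftIdx-suc c n i with i <ᵇ c
... | true  = refl
... | false = +-suc n i

shiftᶜ-single : ∀ c n i A y → shiftᶜ c n (single i A) y ≡ single (shiftIdx c n i) A y
shiftᶜ-single zero    zero    i       A y       = refl
shiftᶜ-single zero    (suc n) i       A zero    = refl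
shiftᶜ-single zero    (suc n) i       A (suc y) = shiftᶜ-single zero n i A y
shiftᶜ-single (suc c) n       zero    A zero    = refl
shiftᶜ-single (suc c) n       (suc i) A zero    rewrite shiftIdx-suc c n i = refl
shiftᶜ-single (suc c) n       zero    A (suc y) with unshiftIdx c n y
... | nothing = refl
... | just j  = refl
shiftᶜ-single (suc c) n (suc i) A (suc y) rewrite shiftIdx-suc c n i
  with unshiftIdx c n y | shiftᶜ-single c n i A y
... | nothing | e = e
... | just j  | e = e

GoodDer : Ctx → Tm → Ty → Set
GoodDer Γ t A = Σ (Γ ⊢ t ∶ A) (Every GoodJ)

GoodDers : Ctx → List Tm → List Ty → Set
GoodDers Γ ss Bs = Σ (Γ ⊢* ss ∶ Bs) (Every* GoodJ)

-- A variable x^A may be replaced by an argument whose type is only ≈ᵀ A.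
GoodDer≈ : Ctx → Tm → Ty → Set
GoodDer≈ Γ t A = ∃[ A′ ] A′ ≈ᵀ A × GoodDer Γ t A′

GoodDers≋ : Ctx → List Tm → List Ty → Set
GoodDers≋ Γ ss Bs = ∃[ Bs′ ] Bs′ ≋ Bs × GoodDers Γ ss Bs′

GoodDer-resp-≈ᶜ : ∀ {Γ Γ′ t A} → Γ ≈ᶜ Γ′ → GoodDer Γ t A → GoodDer Γ′ t A
GoodDer-resp-≈ᶜ {A = A} q (var e , g) = var (≈ᶜ-trans (≈ᶜ-sym q) e) , GoodJ-resp q (≈ᵀ-refl A) g
GoodDer-resp-≈ᶜ {A = A} q (lam {M = M} d , g , ev)
  with d′ , ev′ ← GoodDer-resp-≈ᶜ (∷ᶜ-cong (≈ᴹ-refl M) q) (d , ev) =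
  lam d′ , GoodJ-resp q (≈ᵀ-refl A) g , ev′
GoodDer-resp-≈ᶜ {A = A} q (app d ds m e , g , ev) =
  app d ds m (≈ᶜ-trans (≈ᶜ-sym q) e) , GoodJ-resp q (≈ᵀ-refl A) g , ev

GoodDer≈-resp-≈ᶜ : ∀ {Γ Γ′ t A} → Γ ≈ᶜ Γ′ → GoodDer≈ Γ t A → GoodDer≈ Γ′ t A
GoodDer≈-resp-≈ᶜ q (A′ , a , der) = A′ , a , GoodDer-resp-≈ᶜ q der

GoodDer≈-lam : ∀ {Γ M ℓ t B} → GoodJ Γ (M ⇒[ ℓ ] B) → GoodDer≈ (M ∷ᶜ Γ) t B →
               GoodDer≈ Γ (lam ℓ t) (M ⇒[ ℓ ] B)
GoodDer≈-lam {M = M} {ℓ} g (B′ , b , d , ev) =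
  _ , arr (≈ᴹ-refl M) b , lam d , GoodJ-resp ≈ᶜ-refl (arr {ℓ = ℓ} (≈ᴹ-refl M) (≈ᵀ-sym b)) g , ev

GoodDer≈-app : ∀ {Γ Γt Δ t ss M ℓ A Bs} → GoodJ Γ A → GoodDer≈ Γt t (M ⇒[ ℓ ] A) →
        GoodDers≋ Δ ss Bs → M ≈ᴹ Bs → Γ ≈ᶜ (Γt +ᶜ Δ) → GoodDer≈ Γ (app t ss) A
GoodDer≈-app g (_ , arr m′ a , d , ev) (_ , pw , ds , evs) m e =
  _ , a , app d ds (≈ᴹ-trans m′ (≈ᴹ-trans m (≈ᴹ-sym (≋⇒≈ᴹ pw)))) e ,
  GoodJ-resp ≈ᶜ-refl (≈ᵀ-sym a) g , ev , evs

GoodDers≋-[] : ∀ {Γ} → Γ ≈ᶜ ∅ → GoodDers≋ Γ [] []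
GoodDers≋-[] e = [] , [] , [] e , tt

GoodDers≋-∷ : ∀ {Γ Δ₁ Δ₂ s ss B Bs} → GoodDer≈ Δ₁ s B → GoodDers≋ Δ₂ ss Bs →
      Γ ≈ᶜ (Δ₁ +ᶜ Δ₂) → GoodDers≋ Γ (s ∷ ss) (B ∷ Bs)
GoodDers≋-∷ (_ , b , d , ev) (_ , pw , ds , evs) e = _ , b ∷ pw , _∷_ d ds e , ev , evs

GoodDer-shift : ∀ {Γ t A} c n → GoodDer Γ t A → GoodDer (shiftᶜ c n Γ) (shift c n t) A
GoodDers-shift : ∀ {Γ ss Bs} c n → GoodDers Γ ss Bs → GoodDers (shiftᶜ c n Γ) (shifts c n ss) Bs
GoodDer-shift {A = A} c n (var {i = i} e , g) =
  var (≈ᶜ-trans (shiftᶜ-cong c n e) (≈ᶜ-reflexive (shiftᶜ-single c n i A))) , GoodJ-shiftᶜ c n A g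
GoodDer-shift {A = A} c n (lam {Γ = Γ} {M = M} d , g , ev)
  with d′ , ev′ ← GoodDer-resp-≈ᶜ (shiftᶜ-∷ᶜ c n M Γ) (GoodDer-shift (suc c) n (d , ev)) =
  lam d′ , GoodJ-shiftᶜ c n A g , ev′
GoodDer-shift {A = A} c n (app {Γt = Γt} {Δ = Δ} d ds m e , g , ev , evs)
  with d′ , ev′ ← GoodDer-shift c n (d , ev) | ds′ , evs′ ← GoodDers-shift c n (ds , evs) =
  app d′ ds′ m (≈ᶜ-trans (shiftᶜ-cong c n e) (shiftᶜ-+ᶜ c n Γt Δ)) ,
  GoodJ-shiftᶜ c n A g , ev′ , evs′
GoodDers-shift c n ([] e , _) = [] (≈ᶜ-trans (shiftᶜ-cong c n e) (shiftᶜ-∅ c n)) , tt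
GoodDers-shift c n (_∷_ {Δ₁ = Δ₁} {Δ₂ = Δ₂} d ds e , ev , evs)
  with d′ , ev′ ← GoodDer-shift c n (d , ev) | ds′ , evs′ ← GoodDers-shift c n (ds , evs) =
  _∷_ d′ ds′ (≈ᶜ-trans (shiftᶜ-cong c n e) (shiftᶜ-+ᶜ c n Δ₁ Δ₂)) , ev′ , evs′

ctx≈occ : ∀ {Γ t A} → Γ ⊢ t ∶ A → ∀ y → Γ y ≈ᴹ occ y t
ctx≈occs : ∀ {Γ ss Bs} → Γ ⊢* ss ∶ Bs → ∀ y → Γ y ≈ᴹ occs y ss
ctx≈occ {A = A} (var {i = i} e) y =
  ≈ᴹ-trans (e y) (≈ᴹ-reflexive (cong (λ b → if b then A ∷ [] else []) (≡ᵇ-sym y i)))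
ctx≈occ (lam d)          y = ctx≈occ d (suc y)
ctx≈occ (app d ds _ e)   y = ≈ᴹ-trans (e y) (≈ᴹ-++⁺ (ctx≈occ d y) (ctx≈occs ds y))
ctx≈occs ([] e)          y = e y
ctx≈occs (_∷_ d ds e)    y = ≈ᴹ-trans (e y) (≈ᴹ-++⁺ (ctx≈occ d y) (ctx≈occs ds y))

⊢-type-unique : ∀ {Γ Γ′ t A A′} → Γ ⊢ t ∶ A → Γ′ ⊢ t ∶ A′ → A ≈ᵀ A′
⊢-type-unique (var _)       (var _)        = ≈ᵀ-refl _
⊢-type-unique (lam d)       (lam d′)       =
  arr (≈ᴹ-trans (ctx≈occ d 0) (≈ᴹ-sym (ctx≈occ d′ 0))) (⊢-type-unique d d′)
⊢-type-unique (app d _ _ _) (app d′ _ _ _) with arr _ a ← ⊢-type-unique d d′ = a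

⊢*-types-unique : ∀ {Γ ss Bs Bs′} → Γ ⊢* ss ∶ Bs → Pointwise HasType ss Bs′ → Bs ≋ Bs′
⊢*-types-unique ([] _)       []              = []
⊢*-types-unique (_∷_ d ds _) ((_ , d′) ∷ hs) = ⊢-type-unique d d′ ∷ ⊢*-types-unique ds hs

⊢*⇒HasTypes : ∀ {Δ ss Bs} → Δ ⊢* ss ∶ Bs → Pointwise HasType ss Bs
⊢*⇒HasTypes ([] _)       = []
⊢*⇒HasTypes (_∷_ d ds _) = (_ , d) ∷ ⊢*⇒HasTypes ds

-- Linear substitution

argTm : (σ : List (Tm × Ty)) → Fin (length σ) → Tm
argTm σ k = proj₁ (lookup σ k)

argTy : (σ : List (Tm × Ty)) → Fin (length σ) → Ty
argTy σ k = proj₂ (lookup σ k)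

module _ {σ : List (Tm × Ty)} where

  hits  : ∀ {d v r} → LSub σ d v r → List (Fin (length σ))
  hitss : ∀ {d vs rs} → LSubs σ d vs rs → List (Fin (length σ))
  hits (hit k _ _) = k ∷ []
  hits (below _)   = []
  hits (above _)   = []
  hits (lam p)     = hits p
  hits (app p ps)  = hits p ++ hitss ps
  hitss []         = []
  hitss (p ∷ ps)   = hits p ++ hitss ps

  hits-types  : ∀ {d v r} (p : LSub σ d v r) → map (argTy σ) (hits p) ≋ occ d v
  hitss-types : ∀ {d vs rs} (ps : LSubs σ d vs rs) → map (argTy σ) (hitss ps) ≋ occs d vs
  hits-types {d} (hit k k≈ _) rewrite ≡ᵇ-refl d = k≈ ∷ []
  hits-types (below i<d) rewrite <⇒≡ᵇ-false i<d = []
  hits-types (above d<i) rewrite >⇒≡ᵇ-false d<i = []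
  hits-types (lam p)     = hits-types p
  hits-types (app p ps)  rewrite map-++ (argTy σ) (hits p) (hitss ps) =
    Pointwise.++⁺ (hits-types p) (hitss-types ps)
  hitss-types []         = []
  hitss-types (p ∷ ps)   rewrite map-++ (argTy σ) (hits p) (hitss ps) =
    Pointwise.++⁺ (hits-types p) (hitss-types ps)

  TypeDetermines : Fin (length σ) → Set
  TypeDetermines k = ∀ j → argTy σ j ≈ᵀ argTy σ k → j ≡ k

  hits-determined  : ∀ {d v r} (p : LSub σ d v r) → All TypeDetermines (hits p)
  hitss-determined : ∀ {d vs rs} (ps : LSubs σ d vs rs) → All TypeDetermines (hitss ps)
  hits-determined (hit k k≈ k!) = (λ j j≈ → k! j (≈ᵀ-trans j≈ k≈)) ∷ []
  hits-determined (below _)     = []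
  hits-determined (above _)     = []
  hits-determined (lam p)       = hits-determined p
  hits-determined (app p ps)    = All.++⁺ (hits-determined p) (hitss-determined ps)
  hitss-determined []           = []
  hitss-determined (p ∷ ps)     = All.++⁺ (hits-determined p) (hitss-determined ps)

  hits-↭-allFin : ∀ {d v r} → occ d v ≈ᴹ map proj₂ σ → (p : LSub σ d v r) → hits p ↭ allFin (length σ)
  hits-↭-allFin {d} {v} occ≈ p = map-≈ᴹ⇒↭ (argTy σ) (hits p) (allFin (length σ)) (hits-determined p)
    (≈ᴹ-trans (≋⇒≈ᴹ (hits-types p)) (subst (occ d v ≈ᴹ_) (sym (map-lookup-allFin proj₂ σ)) occ≈))

ArgOK : Tm × Ty → Set
ArgOK (s , B) = ∃[ Δ ] GoodDer≈ Δ s B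

Env : List (Tm × Ty) → Set
Env σ = All ArgOK σ

module _ {σ : List (Tm × Ty)} (env : Env σ) where

  argCtx : Fin (length σ) → Ctx
  argCtx k = proj₁ (All.lookup env (∈-lookup k))

  argDer : ∀ k → GoodDer≈ (argCtx k) (argTm σ k) (argTy σ k)
  argDer k = proj₂ (All.lookup env (∈-lookup k))

  usedCtx : List (Fin (length σ)) → Ctx
  usedCtx []       = ∅
  usedCtx (k ∷ ks) = argCtx k +ᶜ usedCtx ks

  usedCtx-++ : ∀ ks ks′ → usedCtx (ks ++ ks′) ≈ᶜ (usedCtx ks +ᶜ usedCtx ks′)
  usedCtx-++ []       ks′ = ≈ᶜ-refl
  usedCtx-++ (k ∷ ks) ks′ y =
    ≈ᴹ-trans (≈ᴹ-++⁺ (≈ᴹ-refl (argCtx k y)) (usedCtx-++ ks ks′ y)) (≈ᴹ-sym (≈ᴹ-++-assoc (argCtx k y) _ _))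

  usedCtx-↭ : ∀ {ks ks′} → ks ↭ ks′ → usedCtx ks ≈ᶜ usedCtx ks′
  usedCtx-↭ refl                        = ≈ᶜ-refl
  usedCtx-↭ (prep k p)                y = ≈ᴹ-++⁺ (≈ᴹ-refl (argCtx k y)) (usedCtx-↭ p y)
  usedCtx-↭ (swap k k′ p)             y =
    ≈ᴹ-trans (↭⇒≈ᴹ (↭.shifts (argCtx k y) (argCtx k′ y)))
             (≈ᴹ-++⁺ (≈ᴹ-refl (argCtx k′ y)) (≈ᴹ-++⁺ (≈ᴹ-refl (argCtx k y)) (usedCtx-↭ p y)))
  usedCtx-↭ (trans p q)               = ≈ᶜ-trans (usedCtx-↭ p) (usedCtx-↭ q)

  substCtx : ℕ → Ctx → List (Fin (length σ)) → Ctx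
  substCtx d Γ ks = delᶜ d Γ +ᶜ shiftᶜ 0 d (usedCtx ks)

  substCtx-[] : ∀ d Γ → substCtx d Γ [] ≈ᶜ delᶜ d Γ
  substCtx-[] d Γ y =
    ≈ᴹ-trans (≈ᴹ-++⁺ (≈ᴹ-refl (Γ (punchIn d y))) (shiftᶜ-∅ 0 d y)) (≈ᴹ-reflexive (++-identityʳ _))

  substCtx-∷ᶜ : ∀ d M Γ ks → substCtx (suc d) (M ∷ᶜ Γ) ks ≈ᶜ (M ∷ᶜ substCtx d Γ ks)
  substCtx-∷ᶜ d M Γ ks zero    = ≈ᴹ-reflexive (++-identityʳ M)
  substCtx-∷ᶜ d M Γ ks (suc y) = ≈ᴹ-refl _

  substCtx-+ᶜ : ∀ d {Γ Γ₁ Γ₂} → Γ ≈ᶜ (Γ₁ +ᶜ Γ₂) → ∀ ks₁ ks₂ →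
                substCtx d Γ (ks₁ ++ ks₂) ≈ᶜ (substCtx d Γ₁ ks₁ +ᶜ substCtx d Γ₂ ks₂)
  substCtx-+ᶜ d {Γ₁ = Γ₁} {Γ₂} e ks₁ ks₂ y =
    ≈ᴹ-trans (≈ᴹ-++⁺ (e (punchIn d y))
                     (≈ᴹ-trans (shiftᶜ-cong 0 d (usedCtx-++ ks₁ ks₂) y)
                               (shiftᶜ-+ᶜ 0 d (usedCtx ks₁) (usedCtx ks₂) y)))
             (≈ᴹ-interchange (Γ₁ (punchIn d y)) (Γ₂ (punchIn d y)) _ _)

  GoodDer-LSub  : ∀ {d v r Γ A} (p : LSub σ d v r) → GoodDer Γ v A →
                  GoodCtx (substCtx d Γ (hits p)) → GoodDer≈ (substCtx d Γ (hits p)) r A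
  GoodDers-LSub : ∀ {d vs rs Γ Bs} (ps : LSubs σ d vs rs) → GoodDers Γ vs Bs →
                  GoodCtx (substCtx d Γ (hitss ps)) → GoodDers≋ (substCtx d Γ (hitss ps)) rs Bs
  GoodDer-LSub {d} {Γ = Γ} (hit {A = A} k k≈ _) (var e , _) _ with B₀ , b , der ← argDer k =
    B₀ , ≈ᵀ-trans b k≈ , GoodDer-resp-≈ᶜ (≈ᶜ-sym Γ≈) (GoodDer-shift 0 d der)
    where
      Γ≈ : substCtx d Γ (k ∷ []) ≈ᶜ shiftᶜ 0 d (argCtx k)
      Γ≈ = +ᶜ-cong (≈ᶜ-trans (delᶜ-cong d e) (delᶜ-single-≡ d A))
                   (shiftᶜ-cong 0 d (≈ᶜ-reflexive λ y → ++-identityʳ (argCtx k y)))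
  GoodDer-LSub {d} {Γ = Γ} (below {A = A} i<d) (var e , g) gX =
    A , ≈ᵀ-refl A ,
    var (≈ᶜ-trans (substCtx-[] d Γ) (≈ᶜ-trans (delᶜ-cong d e) (delᶜ-single-< A i<d))) ,
    mkGoodJ gX (GoodJ⇒SeqTy {A = A} g)
  GoodDer-LSub {d} {Γ = Γ} (above {A = A} d<i) (var e , g) gX =
    A , ≈ᵀ-refl A ,
    var (≈ᶜ-trans (substCtx-[] d Γ) (≈ᶜ-trans (delᶜ-cong d e) (delᶜ-single-> A d<i))) ,
    mkGoodJ gX (GoodJ⇒SeqTy {A = A} g)
  GoodDer-LSub {d} {Γ = Γ} (lam p) (lam {M = M} {ℓ} {B = B} dt , g , ev) gX =
    GoodDer≈-lam (mkGoodJ {A = M ⇒[ ℓ ] B} gX sq)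
      (GoodDer≈-resp-≈ᶜ Γ≈ (GoodDer-LSub p (dt , ev) (GoodCtx-resp-≈ᶜ (≈ᶜ-sym Γ≈) gM)))
    where
      sq = GoodJ⇒SeqTy {A = M ⇒[ ℓ ] B} g
      Γ≈ = substCtx-∷ᶜ d M Γ (hits p)
      gM : GoodCtx (M ∷ᶜ substCtx d Γ (hits p))
      gM = GoodCtx-∷ᶜ (proj₁ sq , proj₁ (proj₂ sq)) gX
  GoodDer-LSub {d} {A = A} (app p ps) (app {Γt = Γt} {Δ = Δ} dt dss m e , g , ev , evs) gX =
    GoodDer≈-app (mkGoodJ gX (GoodJ⇒SeqTy {A = A} g))
      (GoodDer-LSub p (dt , ev) (proj₁ gX₁₂)) (GoodDers-LSub ps (dss , evs) (proj₂ gX₁₂)) m split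
    where
      split = substCtx-+ᶜ d {Γ₁ = Γt} {Γ₂ = Δ} e (hits p) (hitss ps)
      gX₁₂ = GoodCtx-+ᶜ⁻ split gX
  GoodDers-LSub {d} {Γ = Γ} [] ([] e , _) _ = GoodDers≋-[] (≈ᶜ-trans (substCtx-[] d Γ) (delᶜ-cong d e))
  GoodDers-LSub {d} (p ∷ ps) (_∷_ {Δ₁ = Γt} {Δ₂ = Δ} dt dss e , ev , evs) gX =
    GoodDers≋-∷ (GoodDer-LSub p (dt , ev) (proj₁ gX₁₂)) (GoodDers-LSub ps (dss , evs) (proj₂ gX₁₂)) split
    where
      split = substCtx-+ᶜ d {Γ₁ = Γt} {Γ₂ = Δ} e (hits p) (hitss ps)
      gX₁₂ = GoodCtx-+ᶜ⁻ split gX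

record Contraction (u : Tm) (ss : List Tm) (r : Tm) : Set where
  constructor contraction
  field
    types  : List Ty
    typed  : Pointwise HasType ss types
    occ≈   : occ 0 u ≈ᴹ types
    linear : LSub (zip ss types) 0 u r

Contraction-hits-↭ : ∀ {u ss r} (c : Contraction u ss r) →
  hits (Contraction.linear c) ↭ allFin (length (zip ss (Contraction.types c)))
Contraction-hits-↭ {u} (contraction _ typed occ≈ p) =
  hits-↭-allFin (subst (occ 0 u ≈ᴹ_) (sym (map-proj₂-zip typed)) occ≈) p

usedCtx-map-suc : ∀ {x σ} (ok : ArgOK x) (env : Env σ) ks →
                  usedCtx (ok ∷ env) (map suc ks) ≡ usedCtx env ks
usedCtx-map-suc ok env []       = refl
usedCtx-map-suc ok env (k ∷ ks) = cong (argCtx env k +ᶜ_) (usedCtx-map-suc ok env ks)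

GoodDers⇒Env : ∀ {Δ ss Bs₀ Bs} → GoodDers Δ ss Bs₀ → Bs₀ ≋ Bs →
         Σ[ env ∈ Env (zip ss Bs) ] usedCtx env (allFin (length (zip ss Bs))) ≈ᶜ Δ
GoodDers⇒Env ([] e , _) [] = [] , ≈ᶜ-sym e
GoodDers⇒Env (_∷_ {Δ₁ = Δ₁} d ds e , ev , evs) (b ∷ pw) with env , used≈ ← GoodDers⇒Env (ds , evs) pw =
  ok ∷ env , ≈ᶜ-trans (+ᶜ-cong (≈ᶜ-refl {Δ₁}) (≈ᶜ-trans (≈ᶜ-reflexive (cong-app tail≡)) used≈)) (≈ᶜ-sym e)
  where
    ok = Δ₁ , _ , b , d , ev
    tail≡ : usedCtx (ok ∷ env) (tabulate suc) ≡ usedCtx env (allFin _)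
    tail≡ = ≡.trans (cong (usedCtx (ok ∷ env)) (sym (map-tabulate id suc)))
                    (usedCtx-map-suc ok env (allFin _))

GoodDer-Contraction : ∀ {Γ A ℓ u ss r} → GoodDer Γ (app (lam ℓ u) ss) A → Contraction u ss r →
                      GoodDer≈ Γ r A
GoodDer-Contraction {Γ} {A} (app {Γt = Γt} (lam {M = M} du) ds _ e , g , (_ , evu) , evs)
                    c@(contraction _ typed _ p)
  with env , used≈ ← GoodDers⇒Env (ds , evs) (⊢*-types-unique ds typed) =
  GoodDer≈-resp-≈ᶜ Γ≈
    (GoodDer-LSub env p (du , evu) (GoodCtx-resp-≈ᶜ (≈ᶜ-sym Γ≈) (GoodJ⇒GoodCtx {A = A} g)))
  where
    Γ≈ : substCtx env 0 (M ∷ᶜ Γt) (hits p) ≈ᶜ Γ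
    Γ≈ = ≈ᶜ-trans (+ᶜ-cong (≈ᶜ-refl {Γt}) (≈ᶜ-trans (usedCtx-↭ env (Contraction-hits-↭ c)) used≈))
                  (≈ᶜ-sym e)

Match : List (Tm × Ty) → Ty → Set
Match σ A = Σ[ k ∈ Fin (length σ) ] argTy σ k ≈ᵀ A × (∀ j → argTy σ j ≈ᵀ A → j ≡ k)

LSub-exists  : ∀ {σ} d v → All (Match σ) (occ d v) → ∃[ r ] LSub σ d v r
LSubs-exists : ∀ {σ} d vs → All (Match σ) (occs d vs) → ∃[ rs ] LSubs σ d vs rs
LSub-exists d (var i A) ms with <-cmp i d
... | tri< i<d _ _ = _ , below i<d
... | tri> _ _ d<i = _ , above d<i
... | tri≈ _ refl _ rewrite ≡ᵇ-refl d with (k , k≈ , k!) ∷ [] ← ms = _ , hit k k≈ k!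
LSub-exists d (lam ℓ t) ms with r , p ← LSub-exists (suc d) t ms = _ , lam p
LSub-exists d (app t ts) ms
  with r , p ← LSub-exists d t (All.++⁻ˡ (occ d t) ms) | rs , ps ← LSubs-exists d ts (All.++⁻ʳ (occ d t) ms) =
  _ , app p ps
LSubs-exists d []       ms = [] , []
LSubs-exists d (t ∷ ts) ms
  with r , p ← LSub-exists d t (All.++⁻ˡ (occ d t) ms) | rs , ps ← LSubs-exists d ts (All.++⁻ʳ (occ d t) ms) =
  _ , p ∷ ps

Sequential-argTy-injective : ∀ σ → Sequential (map proj₂ σ) →
  ∀ j k → extLabel (argTy σ j) ≡ extLabel (argTy σ k) → j ≡ k
Sequential-argTy-injective (_ ∷ σ) (_ ∷ _)       zero    zero    _ = refl
Sequential-argTy-injective (_ ∷ σ) (x∉ ∷ _)      zero    (suc k) e =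
  ⊥-elim (All.lookup x∉ (∈-map⁺ extLabel (∈-map⁺ proj₂ (∈-lookup k))) e)
Sequential-argTy-injective (_ ∷ σ) (x∉ ∷ _)      (suc j) zero    e =
  ⊥-elim (All.lookup x∉ (∈-map⁺ extLabel (∈-map⁺ proj₂ (∈-lookup j))) (sym e))
Sequential-argTy-injective (_ ∷ σ) (_ ∷ seq)     (suc j) (suc k) e =
  cong suc (Sequential-argTy-injective σ seq j k e)

All-Match : ∀ σ {M} → M ≈ᴹ map proj₂ σ → Sequential (map proj₂ σ) → All (Match σ) M
All-Match σ m seq = All.map match (≈ᴹ⇒Any m)
  where
    match : ∀ {A} → Any (_≈ᵀ A) (map proj₂ σ) → Match σ A
    match any with a ← Any.map⁻ any =
      Any.index a , Any.lookup-index a ,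
      λ j j≈ → Sequential-argTy-injective σ seq j (Any.index a)
                 (≡.trans (extLabel-≈ᵀ j≈) (sym (extLabel-≈ᵀ (Any.lookup-index a))))

Contraction-exists : ∀ {Γ ℓ u ss A} → GoodDer Γ (app (lam ℓ u) ss) A → ∃[ r ] Contraction u ss r
Contraction-exists {ℓ = ℓ} {u} {ss} (app (lam {M = M} {B = A} du) ds m _ , _ , (g , _) , _)
  = _ , contraction _ typed occ≈ (proj₂ substitution)
  where
    typed = ⊢*⇒HasTypes ds
    types≡ = map-proj₂-zip typed
    occ≈ = ≈ᴹ-trans (≈ᴹ-sym (ctx≈occ du 0)) m
    seq = Sequential-resp-≈ᴹ m (proj₁ (GoodJ⇒SeqTy {A = M ⇒[ ℓ ] A} g))
    substitution = LSub-exists 0 u (All-Match (zip ss _) (subst (occ 0 u ≈ᴹ_) (sym types≡) occ≈)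
                                                       (subst Sequential (sym types≡) seq))

Contraction-→# : ∀ {ℓ u ss r} → Contraction u ss r → app (lam ℓ u) ss →# r
Contraction-→# (contraction Bs typed occ≈ p) = β# Bs typed occ≈ p

-- Lambda labels

lamLabelss-++ : ∀ ts us → lamLabelss (ts ++ us) ≡ lamLabelss ts ++ lamLabelss us
lamLabelss-++ []       us = refl
lamLabelss-++ (t ∷ ts) us =
  ≡.trans (cong (lamLabels t ++_) (lamLabelss-++ ts us)) (sym (++-assoc (lamLabels t) _ _))

lamLabelss-↭ : ∀ {ts us} → ts ↭ us → lamLabelss ts ↭ lamLabelss us
lamLabelss-↭ refl          = ↭-refl
lamLabelss-↭ (prep t p)    = ↭.++⁺ˡ (lamLabels t) (lamLabelss-↭ p)
lamLabelss-↭ (swap t u p)  = ↭-trans (↭.shifts (lamLabels t) (lamLabels u))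
                                     (↭.++⁺ˡ (lamLabels u) (↭.++⁺ˡ (lamLabels t) (lamLabelss-↭ p)))
lamLabelss-↭ (trans p q)   = ↭-trans (lamLabelss-↭ p) (lamLabelss-↭ q)

lamLabels-shift  : ∀ c n t → lamLabels (shift c n t) ≡ lamLabels t
lamLabelss-shift : ∀ c n ts → lamLabelss (shifts c n ts) ≡ lamLabelss ts
lamLabels-shift c n (var _ _)   = refl
lamLabels-shift c n (lam ℓ t)   = cong (ℓ ∷_) (lamLabels-shift (suc c) n t)
lamLabels-shift c n (app t ts)  = cong₂ _++_ (lamLabels-shift c n t) (lamLabelss-shift c n ts)
lamLabelss-shift c n []         = refl
lamLabelss-shift c n (t ∷ ts)   = cong₂ _++_ (lamLabels-shift c n t) (lamLabelss-shift c n ts)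

module _ {σ : List (Tm × Ty)} where

  argLabels : List (Fin (length σ)) → List Label
  argLabels ks = lamLabelss (map (argTm σ) ks)

  argLabels-++ : ∀ ks ks′ → argLabels (ks ++ ks′) ≡ argLabels ks ++ argLabels ks′
  argLabels-++ ks ks′ =
    ≡.trans (cong lamLabelss (map-++ (argTm σ) ks ks′)) (lamLabelss-++ (map (argTm σ) ks) _)

  ↭-++-argLabels : ∀ {x y} xs ys ks ks′ → x ↭ xs ++ argLabels ks → y ↭ ys ++ argLabels ks′ →
                   x ++ y ↭ (xs ++ ys) ++ argLabels (ks ++ ks′)
  ↭-++-argLabels xs ys ks ks′ p q = ↭-trans (↭.++⁺ p q)
    (↭-trans (↭-interchange xs (argLabels ks) ys (argLabels ks′))
             (↭-reflexive (cong ((xs ++ ys) ++_) (sym (argLabels-++ ks ks′)))))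

  lamLabels-LSub  : ∀ {d v r} (p : LSub σ d v r) → lamLabels r ↭ lamLabels v ++ argLabels (hits p)
  lamLabelss-LSub : ∀ {d vs rs} (ps : LSubs σ d vs rs) → lamLabelss rs ↭ lamLabelss vs ++ argLabels (hitss ps)
  lamLabels-LSub {d} (hit k _ _) =
    ↭-reflexive (≡.trans (lamLabels-shift 0 d (argTm σ k)) (sym (++-identityʳ _)))
  lamLabels-LSub (below _)  = ↭-refl
  lamLabels-LSub (above _)  = ↭-refl
  lamLabels-LSub (lam p)    = ↭-prep _ (lamLabels-LSub p)
  lamLabels-LSub (app {t = v} {ss = vs} p ps) =
    ↭-++-argLabels (lamLabels v) (lamLabelss vs) (hits p) (hitss ps) (lamLabels-LSub p) (lamLabelss-LSub ps)
  lamLabelss-LSub []        = ↭-refl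
  lamLabelss-LSub (_∷_ {s = v} {ss = vs} p ps) =
    ↭-++-argLabels (lamLabels v) (lamLabelss vs) (hits p) (hitss ps) (lamLabels-LSub p) (lamLabelss-LSub ps)

lamLabels-Contraction : ∀ {u ss r} → Contraction u ss r → lamLabels r ↭ lamLabels u ++ lamLabelss ss
lamLabels-Contraction {u} {ss} c@(contraction Bs typed _ p) =
  ↭-trans (lamLabels-LSub p) (↭.++⁺ˡ (lamLabels u)
    (↭-trans (lamLabelss-↭ (↭.map⁺ (argTm σ) (Contraction-hits-↭ c)))
             (↭-reflexive (cong lamLabelss (≡.trans (map-lookup-allFin proj₁ σ) (map-proj₁-zip typed))))))
  where σ = zip ss Bs

infix 4 _⊑_
_⊑_ : List Label → List Label → Set
xs ⊑ ys = ∃[ zs ] xs ++ zs ↭ ys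

↭⇒⊑ : ∀ {xs ys} → xs ↭ ys → xs ⊑ ys
↭⇒⊑ {xs} p = [] , ↭-trans (↭-reflexive (++-identityʳ xs)) p

⊑-refl : ∀ {xs} → xs ⊑ xs
⊑-refl = ↭⇒⊑ ↭-refl

⊑-∷⁺ : ∀ {x xs ys} → xs ⊑ ys → x ∷ xs ⊑ x ∷ ys
⊑-∷⁺ (zs , p) = zs , ↭-prep _ p

⊑-∷ʳ : ∀ {x xs ys} → xs ⊑ ys → xs ⊑ x ∷ ys
⊑-∷ʳ {x} {xs} (zs , p) = x ∷ zs , ↭-trans (↭.shift x xs zs) (↭-prep x p)

⊑-++⁺ : ∀ {xs ys us vs} → xs ⊑ ys → us ⊑ vs → xs ++ us ⊑ ys ++ vs
⊑-++⁺ {xs} {us = us} (zs , p) (ws , q) = zs ++ ws , ↭-trans (↭-interchange xs us zs ws) (↭.++⁺ p q)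

Unique-⊑ : ∀ {xs ys} → xs ⊑ ys → Unique ys → Unique xs
Unique-⊑ {xs} (_ , p) u = Unique-++⁻ˡ xs (Unique-resp-↭ (↭-sym p) u)

lamLabels-→#  : ∀ {t s} → t →# s → lamLabels s ⊑ lamLabels t
lamLabelss-→#s : ∀ {ss ss′} → ss →#s ss′ → lamLabelss ss′ ⊑ lamLabelss ss
lamLabels-→# (β# Bs typed occ≈ p) = ⊑-∷ʳ (↭⇒⊑ (lamLabels-Contraction (contraction Bs typed occ≈ p)))
lamLabels-→# (lamξ st)  = ⊑-∷⁺ (lamLabels-→# st)
lamLabels-→# (appL st)  = ⊑-++⁺ (lamLabels-→# st) ⊑-refl
lamLabels-→# (appR st)  = ⊑-++⁺ ⊑-refl (lamLabelss-→#s st)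
lamLabelss-→#s (here st)  = ⊑-++⁺ (lamLabels-→# st) ⊑-refl
lamLabelss-→#s (there st) = ⊑-++⁺ ⊑-refl (lamLabelss-→#s st)

-- Subject reduction

GoodDer-→#  : ∀ {Γ t s A} → GoodDer Γ t A → t →# s → GoodDer≈ Γ s A
GoodDers-→#s : ∀ {Γ ss ss′ Bs} → GoodDers Γ ss Bs → ss →#s ss′ → GoodDers≋ Γ ss′ Bs
GoodDer-→# der (β# Bs typed occ≈ p) = GoodDer-Contraction der (contraction Bs typed occ≈ p)
GoodDer-→# (lam d , g , ev) (lamξ st) = GoodDer≈-lam g (GoodDer-→# (d , ev) st)
GoodDer-→# (app d ds m e , g , ev , evs) (appL st) =
  GoodDer≈-app g (GoodDer-→# (d , ev) st) (_ , ≋-refl _ , ds , evs) m e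
GoodDer-→# (app d ds m e , g , ev , evs) (appR st) =
  GoodDer≈-app g (_ , ≈ᵀ-refl _ , d , ev) (GoodDers-→#s (ds , evs) st) m e
GoodDers-→#s (_∷_ d ds e , ev , evs) (here st)  =
  GoodDers≋-∷ (GoodDer-→# (d , ev) st) (_ , ≋-refl _ , ds , evs) e
GoodDers-→#s (_∷_ d ds e , ev , evs) (there st) =
  GoodDers≋-∷ (_ , ≈ᵀ-refl _ , d , ev) (GoodDers-→#s (ds , evs) st) e

Correct-→# : ∀ {t s} → Correct t → t →# s → Correct s
Correct-→# (Γ , A , d , ev , u) st with A′ , _ , d′ , ev′ ← GoodDer-→# (d , ev) st =
  Γ , A′ , d′ , ev′ , Unique-⊑ (lamLabels-→# st) u

Correct-→#* : ∀ {t s} → Correct t → t →#* s → Correct s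
Correct-→#* c ε          = c
Correct-→#* c (st ◅ sts) = Correct-→#* (Correct-→# c st) sts

-- Refinement and simulation

shift-⋉  : ∀ {t′ t} c n → t′ ⋉ t → shift c n t′ ⋉ shiftΛ c n t
shifts-⋉ : ∀ {ts′ t} c n → All (_⋉ t) ts′ → All (_⋉ shiftΛ c n t) (shifts c n ts′)
shift-⋉ c n var          = var
shift-⋉ c n (lam r)      = lam (shift-⋉ (suc c) n r)
shift-⋉ c n (app r rs)   = app (shift-⋉ c n r) (shifts-⋉ c n rs)
shifts-⋉ c n []          = []
shifts-⋉ c n (r ∷ rs)    = shift-⋉ c n r ∷ shifts-⋉ c n rs

LSub-⋉  : ∀ {σ d v r u s} → LSub σ d v r → v ⋉ u → All ((_⋉ s) ∘ proj₁) σ → r ⋉ substΛ d s u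
LSubs-⋉ : ∀ {σ d vs rs u s} → LSubs σ d vs rs → All (_⋉ u) vs → All ((_⋉ s) ∘ proj₁) σ →
          All (_⋉ substΛ d s u) rs
LSub-⋉ {d = d} (hit k _ _) var args rewrite <ᵇ-irrefl d | ≡ᵇ-refl d =
  shift-⋉ 0 d (All.lookup args (∈-lookup k))
LSub-⋉ (below i<d) var args rewrite <⇒<ᵇ-true i<d = var
LSub-⋉ (above d<i) var args rewrite >⇒<ᵇ-false d<i | >⇒≡ᵇ-false d<i = var
LSub-⋉ (lam p)    (lam r)    args = lam (LSub-⋉ p r args)
LSub-⋉ (app p ps) (app r rs) args = app (LSub-⋉ p r args) (LSubs-⋉ ps rs args)
LSubs-⋉ []       []       args = []
LSubs-⋉ (p ∷ ps) (r ∷ rs) args = LSub-⋉ p r args ∷ LSubs-⋉ ps rs args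

All-zip : ∀ {X Y : Set} {P : X → Set} {xs} {ys : List Y} → All P xs → All (P ∘ proj₁) (zip xs ys)
All-zip                []       = []
All-zip {ys = []}      (_ ∷ _)  = []
All-zip {ys = _ ∷ _}   (p ∷ ps) = p ∷ All-zip ps

Contraction-⋉ : ∀ {u′ ss′ r u s} → Contraction u′ ss′ r → u′ ⋉ u → All (_⋉ s) ss′ → r ⋉ substΛ 0 s u
Contraction-⋉ (contraction _ _ _ p) r rs = LSub-⋉ p r (All-zip rs)

→#*-here : ∀ {s s′ ss} → s →#* s′ → Star _→#s_ (s ∷ ss) (s′ ∷ ss)
→#*-here = gmap _ here

→#*-there : ∀ {s ss ss′} → Star _→#s_ ss ss′ → Star _→#s_ (s ∷ ss) (s ∷ ss′)
→#*-there = gmap _ there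

β-simulation  : ∀ {Γ t′ A t s} → GoodDer Γ t′ A → t′ ⋉ t → t →β s → ∃[ s′ ] t′ →#* s′ × s′ ⋉ s
β-simulations : ∀ {Δ ts′ Bs t s} → GoodDers Δ ts′ Bs → All (_⋉ t) ts′ → t →β s →
                ∃[ ss′ ] Star _→#s_ ts′ ss′ × All (_⋉ s) ss′
β-simulation der (app (lam u′⋉u) ss′⋉s) β with r , c ← Contraction-exists der =
  r , Contraction-→# c ◅ ε , Contraction-⋉ c u′⋉u ss′⋉s
β-simulation (lam d , _ , ev) (lam r) (lamξ st)
  with s′ , sts , r′ ← β-simulation (d , ev) r st =
  _ , gmap _ lamξ sts , lam r′
β-simulation (app d _ _ _ , _ , ev , _) (app r rs) (appL st)
  with s′ , sts , r′ ← β-simulation (d , ev) r st =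
  _ , gmap _ appL sts , app r′ rs
β-simulation (app _ ds _ _ , _ , _ , evs) (app r rs) (appR st)
  with ss′ , sts , rs′ ← β-simulations (ds , evs) rs st =
  _ , gmap _ appR sts , app r rs′
β-simulations ([] _ , _) [] st = [] , ε , []
β-simulations (_∷_ d ds _ , ev , evs) (r ∷ rs) st
  with s′ , sts , r′ ← β-simulation (d , ev) r st | ss′ , stss , rs′ ← β-simulations (ds , evs) rs st =
  _ , →#*-here sts ◅◅ →#*-there stss , r′ ∷ rs′

→#-simulation  : ∀ {Γ t′ A t s′} → GoodDer Γ t′ A → t′ ⋉ t → t′ →# s′ →
                 ∃[ s ] ∃[ s″ ] t →β s × s′ →#* s″ × s″ ⋉ s
→#s-simulation : ∀ {Δ ts′ Bs t ss₁} → GoodDers Δ ts′ Bs → All (_⋉ t) ts′ → ts′ →#s ss₁ →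
                 ∃[ s ] ∃[ ss″ ] t →β s × Star _→#s_ ss₁ ss″ × All (_⋉ s) ss″
→#-simulation _ (app (lam r) rs) (β# Bs typed occ≈ p) =
  _ , _ , β , ε , Contraction-⋉ (contraction Bs typed occ≈ p) r rs
→#-simulation (lam d , _ , ev) (lam r) (lamξ st)
  with s , s″ , stβ , sts , r′ ← →#-simulation (d , ev) r st =
  _ , _ , lamξ stβ , gmap _ lamξ sts , lam r′
→#-simulation (app d _ _ _ , _ , ev , _) (app r rs) (appL st)
  with s , s″ , stβ , sts , r′ ← →#-simulation (d , ev) r st =
  _ , _ , appL stβ , gmap _ appL sts , app r′ rs
→#-simulation (app _ ds _ _ , _ , _ , evs) (app r rs) (appR st)
  with s , ss″ , stβ , sts , rs′ ← →#s-simulation (ds , evs) rs st =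
  _ , _ , appR stβ , gmap _ appR sts , app r rs′
→#s-simulation (_∷_ d ds _ , ev , evs) (r ∷ rs) (here st)
  with s , s″ , stβ , sts , r′ ← →#-simulation (d , ev) r st
  with ss′ , stss , rs′ ← β-simulations (ds , evs) rs stβ =
  s , _ , stβ , →#*-here sts ◅◅ →#*-there stss , r′ ∷ rs′
→#s-simulation (_∷_ d ds _ , ev , evs) (r ∷ rs) (there st)
  with s , ss″ , stβ , stss , rs′ ← →#s-simulation (ds , evs) rs st
  with s′ , sts , r′ ← β-simulation (d , ev) r stβ =
  s , _ , stβ , →#*-here sts ◅◅ →#*-there stss , r′ ∷ rs′

proposition6 : (t' : Tm) (t : Λ) → Correct t' → t' ⋉ t →
    ((s : Λ) → t →β s →
    Σ Tm λ s' → Correct s' × t' →#* s' × s' ⋉ s)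
    × ((s' : Tm) → t' →# s' →
    Σ Λ λ s → Σ Tm λ s'' → Correct s'' × t →β s × s' →#* s'' × s'' ⋉ s)
proposition6 t′ t c@(_ , _ , d , ev , _) t′⋉t = simulate-β , simulate-#
  where
    simulate-β : ∀ s → t →β s → Σ Tm λ s′ → Correct s′ × t′ →#* s′ × s′ ⋉ s
    simulate-β s st with s′ , sts , s′⋉s ← β-simulation (d , ev) t′⋉t st =
      s′ , Correct-→#* c sts , sts , s′⋉s

    simulate-# : ∀ s′ → t′ →# s′ → Σ Λ λ s → Σ Tm λ s″ → Correct s″ × t →β s × s′ →#* s″ × s″ ⋉ s
    simulate-# s′ st with s , s″ , stβ , sts , s″⋉s ← →#-simulation (d , ev) t′⋉t st =
      s , s″ , Correct-→#* c (st ◅ sts) , stβ , sts , s″⋉s
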